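{- Let $m$ be a positive integer and $\lambda$ a nonzero real number. Then, as formal power series in $t$, $$e_{\lambda}(t)\,\frac{1}{1-x\left(\frac{e_{\lambda}^{m}(t)-1}{m}\right)}=\sum_{n=0}^{\infty}\mathcal{F}_{m,\lambda}(n,x)\frac{t^{n}}{n!}.$$
   Context: For a nonzero real $\lambda$: $(x)_{0,\lambda}=1$, $(x)_{n,\lambda}=x(x-\lambda)\cdots(x-(n-1)\lambda)$; $(x)_n=(x)_{n,1}$; $e_\lambda^x(t)=(1+\lambda t)^{x/\lambda}$, $e_\lambda(t)=e_\lambda^1(t)$. Degenerate Whitney numbers of the second kind $W_{m,\lambda}(n,k)$: $(mx+1)_{n,\lambda}=\sum_{k=0}^{n}W_{m,\lambda}(n,k)m^{k}(x)_{k}$. Degenerate Tanny–Dowling polynomials: $\mathcal{F}_{m,\lambda}(n,x)=\sum_{k=0}^{n}k!\,W_{m,\lambda}(n,k)x^{k}$ (equivalently $\int_0^\infty D_{m,\lambda}(n,x\xi)e^{ -\xi}d\xi$ with $D_{m,\lambda}(n,x)=\sum_k W_{m,\lambda}(n,k)x^k$). -}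

module Defs where

open import Level using (Level; _⊔_) renaming (suc to lsuc)
open import Data.Nat using (ℕ; zero; suc; _!; _∸_)
open import Data.Nat.Combinatorics using (_C_)
open import Data.Product using (Σ; ∃; _×_)
open import Relation.Nullary using (¬_)
open import Relation.Binary.Structures using (IsTotalOrder)
open import Algebra.Bundles using (CommutativeRing)

-- The real numbers: a complete ordered field.  Since every complete
-- ordered field is isomorphic to ℝ, quantifying over all of them is the
-- same as speaking about ℝ.

record RealField (c ℓ : Level) : Set (lsuc (c ⊔ ℓ)) where
  field
    commRing : CommutativeRing c ℓ
  open CommutativeRing commRing public hiding (zero)
  field
    _≤_          : Carrier → Carrier → Set ℓ
    isTotalOrder : IsTotalOrder _≈_ _≤_
    1≉0          : ¬ (1# ≈ 0#)
    inverse      : ∀ a → ¬ (a ≈ 0#) → Σ Carrier (λ b → a * b ≈ 1#)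
    +-mono-≤     : ∀ a b z → a ≤ b → (a + z) ≤ (b + z)
    *-nonneg     : ∀ a b → 0# ≤ a → 0# ≤ b → 0# ≤ (a * b)
    complete     : (P : Carrier → Set ℓ) → ∃ P →
                   ∃ (λ b → ∀ a → P a → a ≤ b) →
                   ∃ (λ s → (∀ a → P a → a ≤ s) ×
                            (∀ b → (∀ a → P a → a ≤ b) → s ≤ b))

-- Exponential-generating-function representation of formal power series:
-- a sequence  a : ℕ → Carrier  stands for the series  Σ_n a n · tⁿ/n!.
-- (Two series are equal iff these sequences agree, since n! is invertible.)

module Series {c ℓ : Level} (R : RealField c ℓ) where
  open RealField R

  fromℕ : ℕ → Carrier
  fromℕ zero    = 0#
  fromℕ (suc n) = 1# + fromℕ n

  _^_ : Carrier → ℕ → Carrier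
  a ^ zero  = 1#
  a ^ suc k = (a ^ k) * a

  sumTo : ℕ → (ℕ → Carrier) → Carrier
  sumTo zero    f = f 0
  sumTo (suc n) f = sumTo n f + f (suc n)

  fall : Carrier → Carrier → ℕ → Carrier
  fall a λ′ zero    = 1#
  fall a λ′ (suc n) = fall a λ′ n * (a - fromℕ n * λ′)

  ff : Carrier → ℕ → Carrier
  ff a n = fall a 1# n

  EGF : Set c
  EGF = ℕ → Carrier

  -- product of series in the EGF representation (binomial convolution)
  _⊛_ : EGF → EGF → EGF
  (f ⊛ g) n = sumTo n (λ k → fromℕ (n C k) * (f k * g (n ∸ k)))

  scale : Carrier → EGF → EGF
  scale a f n = a * f n

  oneS : EGF
  oneS zero    = 1#
  oneS (suc n) = 0#

  _⊝_ : EGF → EGF → EGF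
  (f ⊝ g) n = f n - g n

  powS : EGF → ℕ → EGF
  powS f zero    = oneS
  powS f (suc k) = powS f k ⊛ f

  -- 1/(1 - y) = Σ_k y^k for a series y with zero constant term;
  -- the n-th coefficient only receives contributions from k ≤ n.
  geom : EGF → EGF
  geom y n = sumTo n (λ k → powS y k n)

  -- e_λ^a(t) = (1+λt)^{a/λ} = Σ_n (a)_{n,λ} tⁿ/n!
  eλ^ : Carrier → Carrier → EGF
  eλ^ λ′ a n = fall a λ′ n

  eλ : Carrier → EGF
  eλ λ′ = eλ^ λ′ 1#

  TannyDowling : (ℕ → ℕ → Carrier) → ℕ → Carrier → Carrier
  TannyDowling W n x = sumTo n (λ k → fromℕ (k !) * (W n k * (x ^ k)))

  IsDegWhitney2 : ℕ → Carrier → (ℕ → ℕ → Carrier) → Set (c ⊔ ℓ)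
  IsDegWhitney2 m λ′ W = ∀ (n : ℕ) (z : Carrier) →
    fall (fromℕ m * z + 1#) λ′ n ≈
      sumTo n (λ k → W n k * ((fromℕ m ^ k) * ff z k))

-- With y = (e_λ^m(t) − 1)/m the left side is Σ_k x^k e_λ(t) y^k, the sum being finite
-- coefficientwise since y has no constant term.  By e_λ^a e_λ^b = e_λ^{a+b}, the n-th
-- coefficient of e_λ(t) (e_λ^m(t) − 1)^k is the k-th forward difference at w = 0 of
-- w ↦ (mw + 1)_{n,λ} = Σ_j W(n,j) m^j (w)_j.  As Δ^k (w)_j vanishes at 0 unless j = k,
-- where it is k!, this difference is k! W(n,k) m^k, and m^k cancels against the m^{-k} of y^k.
module Submission where

open import Level using (Level)
open import Data.Nat as ℕ using (ℕ; zero; suc; _≤_; _<_; z≤n; s≤s; _∸_; _!; NonZero)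
import Data.Nat.Properties as ℕₚ
open import Data.Nat.Combinatorics using (_C_; nCn≡1; k>n⇒nCk≡0; nCk+nC[k+1]≡[n+1]C[k+1])
open import Data.Product using (_×_; _,_)
open import Data.Sum using (inj₁; inj₂)
open import Data.Maybe using (just; nothing)
open import Relation.Nullary using (¬_; yes; no)
open import Data.Empty using (⊥-elim)
open import Relation.Binary.Definitions using (WeaklyDecidable; tri<; tri≈; tri>)
import Relation.Binary.PropositionalEquality as ≡
open import Algebra.Bundles using (RawRing)
import Algebra.Solver.Ring.AlmostCommutativeRing as ACR
import Algebra.Solver.Ring as Solver
open import Defs

m∸n+n≡m+[n∸m] : ∀ m n → (m ∸ n) ℕ.+ n ≡.≡ m ℕ.+ (n ∸ m)
m∸n+n≡m+[n∸m] zero    zero    = ≡.refl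
m∸n+n≡m+[n∸m] zero    (suc n) = ≡.refl
m∸n+n≡m+[n∸m] (suc m) zero    = ≡.refl
m∸n+n≡m+[n∸m] (suc m) (suc n) =
  ≡.trans (ℕₚ.+-suc (m ∸ n) n) (≡.cong suc (m∸n+n≡m+[n∸m] m n))

module DegenerateSeries {c ℓ : Level} (ℝ : RealField c ℓ) where
  open RealField ℝ hiding (_≤_)
  open Series ℝ
  open import Relation.Binary.Reasoning.Setoid setoid
  open import Algebra.Properties.Ring ring using (x[y-z]≈xy-xz; [y-z]x≈yx-zx)
  open import Algebra.Properties.AbelianGroup +-abelianGroup using (ε⁻¹≈ε; ⁻¹-anti-homo‿-; ⁻¹-∙-comm)
  open import Algebra.Properties.CommutativeSemigroup +-commutativeSemigroup using (interchange)
  open import Algebra.Properties.Semiring.Mult semiring using (×-homo-+; ×1-homo-*) renaming (_×_ to _×ᵤ_)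
  import Algebra.Properties.Semiring.Mult.TCOptimised semiring as TC

  [a-b]+[c-d]≈[a+c]-[b+d] : ∀ a b c d → (a - b) + (c - d) ≈ (a + c) - (b + d)
  [a-b]+[c-d]≈[a+c]-[b+d] a b c d = trans (interchange a (- b) c (- d)) (+-congˡ (⁻¹-∙-comm b d))

  a+d≈c+b⇒a-b≈c-d : ∀ a b c d → a + d ≈ c + b → a - b ≈ c - d
  a+d≈c+b⇒a-b≈c-d a b c d eq = begin
    a - b             ≈⟨ x-y≈[x+u]-[y+u] a b d ⟩
    (a + d) - (b + d) ≈⟨ +-cong eq (-‿cong (+-comm b d)) ⟩
    (c + b) - (d + b) ≈⟨ x-y≈[x+u]-[y+u] c d b ⟨
    c - d             ∎
    where
    x-y≈[x+u]-[y+u] : ∀ x y u → x - y ≈ (x + u) - (y + u)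
    x-y≈[x+u]-[y+u] x y u = begin
      x - y             ≈⟨ +-identityʳ _ ⟨
      (x - y) + 0#      ≈⟨ +-congˡ (-‿inverseʳ u) ⟨
      (x - y) + (u - u) ≈⟨ [a-b]+[c-d]≈[a+c]-[b+d] x y u u ⟩
      (x + u) - (y + u) ∎

  [a-b]*[c-d]≈[ac+bd]-[ad+bc] : ∀ a b c d → (a - b) * (c - d) ≈ (a * c + b * d) - (a * d + b * c)
  [a-b]*[c-d]≈[ac+bd]-[ad+bc] a b c d = begin
    (a - b) * (c - d)                 ≈⟨ [y-z]x≈yx-zx (c - d) a b ⟩
    a * (c - d) - b * (c - d)         ≈⟨ +-cong (x[y-z]≈xy-xz a c d) (-‿cong (x[y-z]≈xy-xz b c d)) ⟩
    (a * c - a * d) - (b * c - b * d) ≈⟨ +-congˡ (⁻¹-anti-homo‿- (b * c) (b * d)) ⟩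
    (a * c - a * d) + (b * d - b * c) ≈⟨ [a-b]+[c-d]≈[a+c]-[b+d] _ _ _ _ ⟩
    (a * c + b * d) - (a * d + b * c) ∎

  fromℕ≈×1 : ∀ n → fromℕ n ≈ n ×ᵤ 1#
  fromℕ≈×1 zero    = refl
  fromℕ≈×1 (suc n) = +-congˡ (fromℕ≈×1 n)

  fromℕ-+ : ∀ a b → fromℕ (a ℕ.+ b) ≈ fromℕ a + fromℕ b
  fromℕ-+ a b = begin
    fromℕ (a ℕ.+ b)   ≈⟨ fromℕ≈×1 (a ℕ.+ b) ⟩
    (a ℕ.+ b) ×ᵤ 1#   ≈⟨ ×-homo-+ 1# a b ⟩
    a ×ᵤ 1# + b ×ᵤ 1# ≈⟨ +-cong (fromℕ≈×1 a) (fromℕ≈×1 b) ⟨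
    fromℕ a + fromℕ b ∎

  fromℕ-* : ∀ a b → fromℕ (a ℕ.* b) ≈ fromℕ a * fromℕ b
  fromℕ-* a b = begin
    fromℕ (a ℕ.* b)       ≈⟨ fromℕ≈×1 (a ℕ.* b) ⟩
    (a ℕ.* b) ×ᵤ 1#       ≈⟨ ×1-homo-* a b ⟩
    (a ×ᵤ 1#) * (b ×ᵤ 1#) ≈⟨ *-cong (fromℕ≈×1 a) (fromℕ≈×1 b) ⟨
    fromℕ a * fromℕ b     ∎

  -- Coefficients for the ring solver: integers as normalised pairs (a , b)
  -- standing for a − b.  The evaluation sends (1 , 0) to 1# on the nose,
  -- so that the constants of solved equations match those of the goals.
  module DifferenceCoefficients where
    N : ℕ → Carrier
    N a = TC._×_ a 1#

    normalise : ℕ × ℕ → ℕ × ℕ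
    normalise (a , b) = (a ∸ b , b ∸ a)

    rawRing′ : RawRing _ _
    rawRing′ = record
      { Carrier = ℕ × ℕ
      ; _≈_     = ≡._≡_
      ; _+_     = λ { (a , b) (c , d) → normalise (a ℕ.+ c , b ℕ.+ d) }
      ; _*_     = λ { (a , b) (c , d) → normalise (a ℕ.* c ℕ.+ b ℕ.* d , a ℕ.* d ℕ.+ b ℕ.* c) }
      ; -_      = λ { (a , b) → (b , a) }
      ; 0#      = (0 , 0)
      ; 1#      = (1 , 0)
      }

    ⟦_⟧ : ℕ × ℕ → Carrier
    ⟦ (a , zero) ⟧  = N a
    ⟦ (a , suc b) ⟧ = N a - N (suc b)

    ⟦⟧≈ : ∀ a b → ⟦ (a , b) ⟧ ≈ N a - N b
    ⟦⟧≈ a zero    = sym (trans (+-congˡ ε⁻¹≈ε) (+-identityʳ _))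
    ⟦⟧≈ a (suc b) = refl

    ⟦⟧-cong : ∀ a b c d → a ℕ.+ d ≡.≡ c ℕ.+ b → ⟦ (a , b) ⟧ ≈ ⟦ (c , d) ⟧
    ⟦⟧-cong a b c d eq = begin
      ⟦ (a , b) ⟧ ≈⟨ ⟦⟧≈ a b ⟩
      N a - N b   ≈⟨ a+d≈c+b⇒a-b≈c-d _ _ _ _ (begin
        N a + N d   ≈⟨ TC.×-homo-+ 1# a d ⟨
        N (a ℕ.+ d) ≡⟨ ≡.cong N eq ⟩
        N (c ℕ.+ b) ≈⟨ TC.×-homo-+ 1# c b ⟩
        N c + N b   ∎) ⟩
      N c - N d   ≈⟨ ⟦⟧≈ c d ⟨
      ⟦ (c , d) ⟧ ∎

    ⟦normalise⟧ : ∀ a b → ⟦ normalise (a , b) ⟧ ≈ ⟦ (a , b) ⟧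
    ⟦normalise⟧ a b = ⟦⟧-cong (a ∸ b) (b ∸ a) a b (m∸n+n≡m+[n∸m] a b)

    N-+ : ∀ a b → N (a ℕ.+ b) ≈ N a + N b
    N-+ = TC.×-homo-+ 1#

    N-+* : ∀ a b c d → N (a ℕ.* b ℕ.+ c ℕ.* d) ≈ N a * N b + N c * N d
    N-+* a b c d = trans (N-+ (a ℕ.* b) (c ℕ.* d)) (+-cong (TC.×1-homo-* a b) (TC.×1-homo-* c d))

    +-homo : ∀ a b c d → ⟦ normalise (a ℕ.+ c , b ℕ.+ d) ⟧ ≈ ⟦ (a , b) ⟧ + ⟦ (c , d) ⟧
    +-homo a b c d = begin
      ⟦ normalise (a ℕ.+ c , b ℕ.+ d) ⟧ ≈⟨ ⟦normalise⟧ (a ℕ.+ c) (b ℕ.+ d) ⟩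
      ⟦ (a ℕ.+ c , b ℕ.+ d) ⟧           ≈⟨ ⟦⟧≈ (a ℕ.+ c) (b ℕ.+ d) ⟩
      N (a ℕ.+ c) - N (b ℕ.+ d)         ≈⟨ +-cong (N-+ a c) (-‿cong (N-+ b d)) ⟩
      (N a + N c) - (N b + N d)         ≈⟨ [a-b]+[c-d]≈[a+c]-[b+d] _ _ _ _ ⟨
      (N a - N b) + (N c - N d)         ≈⟨ +-cong (⟦⟧≈ a b) (⟦⟧≈ c d) ⟨
      ⟦ (a , b) ⟧ + ⟦ (c , d) ⟧         ∎

    *-homo : ∀ a b c d →
      ⟦ normalise (a ℕ.* c ℕ.+ b ℕ.* d , a ℕ.* d ℕ.+ b ℕ.* c) ⟧ ≈ ⟦ (a , b) ⟧ * ⟦ (c , d) ⟧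
    *-homo a b c d = begin
      ⟦ normalise (ac+bd , ad+bc) ⟧                      ≈⟨ ⟦normalise⟧ ac+bd ad+bc ⟩
      ⟦ (ac+bd , ad+bc) ⟧                                ≈⟨ ⟦⟧≈ ac+bd ad+bc ⟩
      N ac+bd - N ad+bc                                  ≈⟨ +-cong (N-+* a c b d) (-‿cong (N-+* a d b c)) ⟩
      (N a * N c + N b * N d) - (N a * N d + N b * N c)  ≈⟨ [a-b]*[c-d]≈[ac+bd]-[ad+bc] _ _ _ _ ⟨
      (N a - N b) * (N c - N d)                          ≈⟨ *-cong (⟦⟧≈ a b) (⟦⟧≈ c d) ⟨
      ⟦ (a , b) ⟧ * ⟦ (c , d) ⟧                          ∎
      where
      ac+bd = a ℕ.* c ℕ.+ b ℕ.* d
      ad+bc = a ℕ.* d ℕ.+ b ℕ.* c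

    -‿homo : ∀ a b → ⟦ (b , a) ⟧ ≈ - ⟦ (a , b) ⟧
    -‿homo a b = begin
      ⟦ (b , a) ⟧   ≈⟨ ⟦⟧≈ b a ⟩
      N b - N a     ≈⟨ ⁻¹-anti-homo‿- (N a) (N b) ⟨
      - (N a - N b) ≈⟨ -‿cong (⟦⟧≈ a b) ⟨
      - ⟦ (a , b) ⟧ ∎

    morphism : rawRing′ ACR.-Raw-AlmostCommutative⟶ ACR.fromCommutativeRing commRing
    morphism = record
      { ⟦_⟧    = ⟦_⟧
      ; +-homo = λ { (a , b) (c , d) → +-homo a b c d }
      ; *-homo = λ { (a , b) (c , d) → *-homo a b c d }
      ; -‿homo = λ { (a , b) → -‿homo a b }
      ; 0-homo = refl
      ; 1-homo = refl
      }

    _≟_ : WeaklyDecidable (ACR.Induced-equivalence morphism)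
    (a , b) ≟ (c , d) with a ℕ.+ d ℕ.≟ c ℕ.+ b
    ... | yes eq = just (⟦⟧-cong a b c d eq)
    ... | no _   = nothing

  open Solver DifferenceCoefficients.rawRing′ (ACR.fromCommutativeRing commRing)
              DifferenceCoefficients.morphism DifferenceCoefficients._≟_
    using (Polynomial; solve; _:=_; _:+_; _:*_; _:-_; con)

  :0 :1 : ∀ {k} → Polynomial k
  :0 = con (0 , 0)
  :1 = con (1 , 0)

  ^-distribʳ-* : ∀ a b k → (a * b) ^ k ≈ (a ^ k) * (b ^ k)
  ^-distribʳ-* a b zero    = sym (*-identityˡ _)
  ^-distribʳ-* a b (suc k) = trans (*-congʳ (^-distribʳ-* a b k))
    (solve 4 (λ x y a b → (x :* y) :* (a :* b) := (x :* a) :* (y :* b)) refl (a ^ k) (b ^ k) a b)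

  1#^ : ∀ k → 1# ^ k ≈ 1#
  1#^ zero    = refl
  1#^ (suc k) = trans (*-identityʳ _) (1#^ k)

  ^-congˡ : ∀ k {a b} → a ≈ b → a ^ k ≈ b ^ k
  ^-congˡ zero    a≈b = refl
  ^-congˡ (suc k) a≈b = *-cong (^-congˡ k a≈b) a≈b

  -- Finite sums

  sumTo-cong : ∀ n {f g : ℕ → Carrier} → (∀ k → k ≤ n → f k ≈ g k) → sumTo n f ≈ sumTo n g
  sumTo-cong zero    f≈g = f≈g 0 z≤n
  sumTo-cong (suc n) f≈g =
    +-cong (sumTo-cong n (λ k k≤n → f≈g k (ℕₚ.m≤n⇒m≤1+n k≤n))) (f≈g (suc n) ℕₚ.≤-refl)

  sumTo-+ : ∀ n (f g : ℕ → Carrier) → sumTo n (λ k → f k + g k) ≈ sumTo n f + sumTo n g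
  sumTo-+ zero    f g = refl
  sumTo-+ (suc n) f g = trans (+-congʳ (sumTo-+ n f g)) (interchange _ _ _ _)

  sumTo-neg : ∀ n (f : ℕ → Carrier) → sumTo n (λ k → - f k) ≈ - sumTo n f
  sumTo-neg zero    f = refl
  sumTo-neg (suc n) f = trans (+-congʳ (sumTo-neg n f)) (⁻¹-∙-comm _ _)

  sumTo-- : ∀ n (f g : ℕ → Carrier) → sumTo n (λ k → f k - g k) ≈ sumTo n f - sumTo n g
  sumTo-- n f g = trans (sumTo-+ n f (λ k → - g k)) (+-congˡ (sumTo-neg n g))

  *-distribˡ-sumTo : ∀ n a (f : ℕ → Carrier) → a * sumTo n f ≈ sumTo n (λ k → a * f k)
  *-distribˡ-sumTo zero    a f = refl
  *-distribˡ-sumTo (suc n) a f = trans (distribˡ _ _ _) (+-congʳ (*-distribˡ-sumTo n a f))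

  *-distribʳ-sumTo : ∀ n a (f : ℕ → Carrier) → sumTo n f * a ≈ sumTo n (λ k → f k * a)
  *-distribʳ-sumTo zero    a f = refl
  *-distribʳ-sumTo (suc n) a f = trans (distribʳ _ _ _) (+-congʳ (*-distribʳ-sumTo n a f))

  sumTo-zero : ∀ n (f : ℕ → Carrier) → (∀ k → k ≤ n → f k ≈ 0#) → sumTo n f ≈ 0#
  sumTo-zero n f f≈0 = trans (sumTo-cong n f≈0) (zeros n)
    where
    zeros : ∀ n → sumTo n (λ _ → 0#) ≈ 0#
    zeros zero    = refl
    zeros (suc n) = trans (+-identityʳ _) (zeros n)

  sumTo-comm : ∀ n m (h : ℕ → ℕ → Carrier) →
    sumTo n (λ i → sumTo m (λ k → h i k)) ≈ sumTo m (λ k → sumTo n (λ i → h i k))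
  sumTo-comm zero    m h = refl
  sumTo-comm (suc n) m h =
    trans (+-congʳ (sumTo-comm n m h)) (sym (sumTo-+ m (λ k → sumTo n (λ i → h i k)) (h (suc n))))

  sumTo-suc : ∀ n (f : ℕ → Carrier) → sumTo (suc n) f ≈ f 0 + sumTo n (λ k → f (suc k))
  sumTo-suc zero    f = refl
  sumTo-suc (suc n) f = trans (+-congʳ (sumTo-suc n f)) (+-assoc _ _ _)

  sumTo-truncate : ∀ n j (f : ℕ → Carrier) → j ≤ n → (∀ k → j < k → k ≤ n → f k ≈ 0#) →
                   sumTo n f ≈ sumTo j f
  sumTo-truncate zero    zero f z≤n  _   = refl
  sumTo-truncate (suc n) j    f j≤1+n f≈0 with ℕₚ.m≤n⇒m<n∨m≡n j≤1+n
  ... | inj₂ ≡.refl    = refl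
  ... | inj₁ (s≤s j≤n) = trans
    (+-cong (sumTo-truncate n j f j≤n (λ k j<k k≤n → f≈0 k j<k (ℕₚ.m≤n⇒m≤1+n k≤n)))
            (f≈0 (suc n) (s≤s j≤n) ℕₚ.≤-refl))
    (+-identityʳ _)

  sumTo-last : ∀ n (f : ℕ → Carrier) → (∀ k → k < n → f k ≈ 0#) → sumTo n f ≈ f n
  sumTo-last zero    f _   = refl
  sumTo-last (suc n) f f≈0 =
    trans (+-congʳ (sumTo-zero n f (λ k k≤n → f≈0 k (s≤s k≤n)))) (+-identityˡ _)

  sumTo-single : ∀ n k (f : ℕ → Carrier) → k ≤ n → (∀ j → j ≤ n → ¬ j ≡.≡ k → f j ≈ 0#) →
                 sumTo n f ≈ f k
  sumTo-single n k f k≤n f≈0 = begin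
    sumTo n f ≈⟨ sumTo-truncate n k f k≤n (λ j k<j j≤n → f≈0 j j≤n (ℕₚ.>⇒≢ k<j)) ⟩
    sumTo k f ≈⟨ sumTo-last k f (λ j j<k → f≈0 j (ℕₚ.≤-trans (ℕₚ.<⇒≤ j<k) k≤n) (ℕₚ.<⇒≢ j<k)) ⟩
    f k       ∎

  -- Forward differences and falling factorials

  Δ : (Carrier → Carrier) → Carrier → Carrier
  Δ f w = f (w + 1#) - f w

  Δ^ : ℕ → (Carrier → Carrier) → Carrier → Carrier
  Δ^ zero    f = f
  Δ^ (suc k) f = Δ^ k (Δ f)

  Δ^-cong : ∀ k {f g : Carrier → Carrier} → (∀ w → f w ≈ g w) → ∀ z → Δ^ k f z ≈ Δ^ k g z
  Δ^-cong zero    f≈g = f≈g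
  Δ^-cong (suc k) f≈g = Δ^-cong k (λ w → +-cong (f≈g (w + 1#)) (-‿cong (f≈g w)))

  Δ^-linear : ∀ k n (a : ℕ → Carrier) (h : ℕ → Carrier → Carrier) z →
    Δ^ k (λ w → sumTo n (λ i → a i * h i w)) z ≈ sumTo n (λ i → a i * Δ^ k (h i) z)
  Δ^-linear zero    n a h z = refl
  Δ^-linear (suc k) n a h z =
    trans (Δ^-cong k Δ-sumTo z) (Δ^-linear k n a (λ i → Δ (h i)) z)
    where
    Δ-sumTo : ∀ w → Δ (λ v → sumTo n (λ i → a i * h i v)) w ≈ sumTo n (λ i → a i * Δ (h i) w)
    Δ-sumTo w = trans (sym (sumTo-- n _ _)) (sumTo-cong n (λ i _ → sym (x[y-z]≈xy-xz _ _ _)))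

  Δ^-*ˡ : ∀ k a (f : Carrier → Carrier) z → Δ^ k (λ w → a * f w) z ≈ a * Δ^ k f z
  Δ^-*ˡ k a f = Δ^-linear k 0 (λ _ → a) (λ _ → f)

  fall-cong : ∀ λ′ n {a b} → a ≈ b → fall a λ′ n ≈ fall b λ′ n
  fall-cong λ′ zero    a≈b = refl
  fall-cong λ′ (suc n) a≈b = *-cong (fall-cong λ′ n a≈b) (+-congʳ a≈b)

  fall-0# : ∀ λ′ n → fall 0# λ′ (suc n) ≈ 0#
  fall-0# λ′ zero    = solve 1 (λ l → :1 :* (:0 :- :0 :* l) := :0) refl λ′
  fall-0# λ′ (suc n) = trans (*-congʳ (fall-0# λ′ n)) (zeroˡ _)

  ff-+1 : ∀ a k → ff (a + 1#) (suc k) ≈ (a + 1#) * ff a k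
  ff-+1 a zero    = solve 1 (λ a → :1 :* ((a :+ :1) :- :0 :* :1) := (a :+ :1) :* :1) refl a
  ff-+1 a (suc k) = trans (*-congʳ (ff-+1 a k)) (solve 3
    (λ a f k → ((a :+ :1) :* f) :* ((a :+ :1) :- (:1 :+ k) :* :1) := (a :+ :1) :* (f :* (a :- k :* :1)))
    refl a (ff a k) (fromℕ k))

  ff-fromℕ-suc : ∀ j k → ff (fromℕ (suc j)) (suc k) ≈ fromℕ (suc j) * ff (fromℕ j) k
  ff-fromℕ-suc j k = begin
    ff (1# + fromℕ j) (suc k)       ≈⟨ fall-cong 1# (suc k) (+-comm 1# (fromℕ j)) ⟩
    ff (fromℕ j + 1#) (suc k)       ≈⟨ ff-+1 (fromℕ j) k ⟩
    (fromℕ j + 1#) * ff (fromℕ j) k ≈⟨ *-congʳ (+-comm (fromℕ j) 1#) ⟩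
    (1# + fromℕ j) * ff (fromℕ j) k ∎

  ff-fromℕ-diag : ∀ k → ff (fromℕ k) k ≈ fromℕ (k !)
  ff-fromℕ-diag zero    = sym (+-identityʳ _)
  ff-fromℕ-diag (suc k) = begin
    ff (fromℕ (suc k)) (suc k)     ≈⟨ ff-fromℕ-suc k k ⟩
    fromℕ (suc k) * ff (fromℕ k) k ≈⟨ *-congˡ (ff-fromℕ-diag k) ⟩
    fromℕ (suc k) * fromℕ (k !)    ≈⟨ fromℕ-* (suc k) (k !) ⟨
    fromℕ (suc k !)                ∎

  ff-fromℕ-vanish : ∀ j k → j < k → ff (fromℕ j) k ≈ 0#
  ff-fromℕ-vanish j (suc k) (s≤s j≤k) with ℕₚ.m≤n⇒m<n∨m≡n j≤k
  ... | inj₁ j<k    = trans (*-congʳ (ff-fromℕ-vanish j k j<k)) (zeroˡ _)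
  ... | inj₂ ≡.refl =
    trans (*-congˡ (trans (+-congˡ (-‿cong (*-identityʳ _))) (-‿inverseʳ _))) (zeroʳ _)

  Δ-ff : ∀ j w → Δ (λ v → ff v j) w ≈ fromℕ j * ff w (j ∸ 1)
  Δ-ff zero    w = solve 0 (:1 :- :1 := :0 :* :1) refl
  Δ-ff (suc j) w = trans (+-congʳ (ff-+1 w j))
    (solve 3 (λ w f j → (w :+ :1) :* f :- f :* (w :- j :* :1) := (:1 :+ j) :* f) refl w (ff w j) (fromℕ j))

  Δ^-ff : ∀ k j z → Δ^ k (λ w → ff w j) z ≈ ff (fromℕ j) k * ff z (j ∸ k)
  Δ^-ff zero    j z = sym (*-identityˡ _)
  Δ^-ff (suc k) j z = begin
    Δ^ k (Δ (λ w → ff w j)) z                           ≈⟨ Δ^-cong k (Δ-ff j) z ⟩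
    Δ^ k (λ w → fromℕ j * ff w (j ∸ 1)) z               ≈⟨ Δ^-*ˡ k (fromℕ j) _ z ⟩
    fromℕ j * Δ^ k (λ w → ff w (j ∸ 1)) z               ≈⟨ *-congˡ (Δ^-ff k (j ∸ 1) z) ⟩
    fromℕ j * (ff (fromℕ (j ∸ 1)) k * ff z (j ∸ 1 ∸ k)) ≈⟨ absorb j ⟩
    ff (fromℕ j) (suc k) * ff z (j ∸ suc k)             ∎
    where
    absorb : ∀ j → fromℕ j * (ff (fromℕ (j ∸ 1)) k * ff z (j ∸ 1 ∸ k)) ≈ ff (fromℕ j) (suc k) * ff z (j ∸ suc k)
    absorb zero    = trans (zeroˡ _) (sym (trans (*-congʳ (fall-0# 1# k)) (zeroˡ _)))
    absorb (suc j) = trans (sym (*-assoc _ _ _)) (*-congʳ (sym (ff-fromℕ-suc j k)))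

  Δ^-ff-0#-diag : ∀ k → Δ^ k (λ w → ff w k) 0# ≈ fromℕ (k !)
  Δ^-ff-0#-diag k = begin
    Δ^ k (λ w → ff w k) 0#            ≈⟨ Δ^-ff k k 0# ⟩
    ff (fromℕ k) k * ff 0# (k ∸ k)    ≡⟨ ≡.cong (λ i → ff (fromℕ k) k * ff 0# i) (ℕₚ.n∸n≡0 k) ⟩
    ff (fromℕ k) k * 1#               ≈⟨ *-identityʳ _ ⟩
    ff (fromℕ k) k                    ≈⟨ ff-fromℕ-diag k ⟩
    fromℕ (k !)                       ∎

  Δ^-ff-0#-offdiag : ∀ k j → ¬ j ≡.≡ k → Δ^ k (λ w → ff w j) 0# ≈ 0#
  Δ^-ff-0#-offdiag k j j≢k with ℕₚ.<-cmp j k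
  ... | tri< j<k _ _ = trans (Δ^-ff k j 0#) (trans (*-congʳ (ff-fromℕ-vanish j k j<k)) (zeroˡ _))
  ... | tri≈ _ j≡k _ = ⊥-elim (j≢k j≡k)
  ... | tri> _ _ k<j = trans (Δ^-ff k j 0#) (trans (*-congˡ (begin
    ff 0# (j ∸ k)             ≡⟨ ≡.cong (ff 0#) (ℕₚ.+-∸-assoc 1 k<j) ⟩
    ff 0# (suc (j ∸ suc k))   ≈⟨ fall-0# 1# (j ∸ suc k) ⟩
    0#                        ∎)) (zeroʳ _))

  Δ^-newton : ∀ n k (a : ℕ → Carrier) → k ≤ n →
    Δ^ k (λ w → sumTo n (λ j → a j * ff w j)) 0# ≈ a k * fromℕ (k !)
  Δ^-newton n k a k≤n = begin
    Δ^ k (λ w → sumTo n (λ j → a j * ff w j)) 0#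
      ≈⟨ Δ^-linear k n a (λ j w → ff w j) 0# ⟩
    sumTo n (λ j → a j * Δ^ k (λ w → ff w j) 0#)
      ≈⟨ sumTo-single n k _ k≤n (λ j _ j≢k → trans (*-congˡ (Δ^-ff-0#-offdiag k j j≢k)) (zeroʳ _)) ⟩
    a k * Δ^ k (λ w → ff w k) 0#
      ≈⟨ *-congˡ (Δ^-ff-0#-diag k) ⟩
    a k * fromℕ (k !) ∎

  -- Exponential generating functions

  shift : EGF → EGF
  shift f n = f (suc n)

  ⊛-cong : ∀ n {f f′ g g′ : EGF} → (∀ k → k ≤ n → f k ≈ f′ k) → (∀ k → k ≤ n → g k ≈ g′ k) →
           (f ⊛ g) n ≈ (f′ ⊛ g′) n
  ⊛-cong n f≈f′ g≈g′ = sumTo-cong n (λ k k≤n → *-congˡ (*-cong (f≈f′ k k≤n) (g≈g′ (n ∸ k) (ℕₚ.m∸n≤m n k))))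

  ⊛-identityʳ : ∀ (f : EGF) n → (f ⊛ oneS) n ≈ f n
  ⊛-identityʳ f n = begin
    (f ⊛ oneS) n                         ≈⟨ sumTo-last n _ (λ k k<n → a*[b*0]≈0 (oneS-∸ k<n)) ⟩
    fromℕ (n C n) * (f n * oneS (n ∸ n)) ≡⟨ ≡.cong₂ (λ i j → fromℕ i * (f n * oneS j)) (nCn≡1 n) (ℕₚ.n∸n≡0 n) ⟩
    (1# + 0#) * (f n * 1#)               ≈⟨ solve 1 (λ x → (:1 :+ :0) :* (x :* :1) := x) refl (f n) ⟩
    f n                                  ∎
    where
    oneS-∸ : ∀ {k n} → k < n → oneS (n ∸ k) ≡.≡ 0#
    oneS-∸ {k} {suc n} (s≤s k≤n) = ≡.cong oneS (ℕₚ.+-∸-assoc 1 k≤n)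
    a*[b*0]≈0 : ∀ {a b z} → z ≡.≡ 0# → a * (b * z) ≈ 0#
    a*[b*0]≈0 ≡.refl = trans (*-congˡ (zeroʳ _)) (zeroʳ _)

  ⊛-⊝ : ∀ (f g h : EGF) n → (f ⊛ (g ⊝ h)) n ≈ (f ⊛ g) n - (f ⊛ h) n
  ⊛-⊝ f g h n = trans
    (sumTo-cong n (λ k _ → solve 4 (λ c x y z → c :* (x :* (y :- z)) := c :* (x :* y) :- c :* (x :* z))
                                   refl (fromℕ (n C k)) (f k) (g (n ∸ k)) (h (n ∸ k))))
    (sumTo-- n _ _)

  ⊛-scaleʳ : ∀ a (f g : EGF) n → (f ⊛ scale a g) n ≈ a * (f ⊛ g) n
  ⊛-scaleʳ a f g n = trans
    (sumTo-cong n (λ k _ → solve 4 (λ c x y z → c :* (x :* (y :* z)) := y :* (c :* (x :* z)))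
                                   refl (fromℕ (n C k)) (f k) a (g (n ∸ k))))
    (sym (*-distribˡ-sumTo n a _))

  -- shift is the derivative of exponential generating functions; this is the Leibniz rule.
  ⊛-leibniz : ∀ (f g : EGF) n → (f ⊛ g) (suc n) ≈ (shift f ⊛ g) n + (f ⊛ shift g) n
  ⊛-leibniz f g n = begin
    (f ⊛ g) (suc n)
      ≈⟨ sumTo-suc n _ ⟩
    x₀ + sumTo n (λ k → fromℕ (suc n C suc k) * (f (suc k) * g (n ∸ k)))
      ≈⟨ +-congˡ (trans (sumTo-cong n (λ k _ → pascal k)) (sumTo-+ n _ _)) ⟩
    x₀ + ((shift f ⊛ g) n + rest)
      ≈⟨ solve 3 (λ x s r → x :+ (s :+ r) := s :+ (x :+ r)) refl x₀ _ rest ⟩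
    (shift f ⊛ g) n + (x₀ + rest)
      ≈⟨ +-congˡ f⊛shift-g ⟨
    (shift f ⊛ g) n + (f ⊛ shift g) n ∎
    where
    x₀ rest : Carrier
    x₀   = fromℕ (suc n C 0) * (f 0 * g (suc n))
    rest = sumTo n (λ k → fromℕ (n C suc k) * (f (suc k) * g (n ∸ k)))

    pascal : ∀ k → fromℕ (suc n C suc k) * (f (suc k) * g (n ∸ k))
                   ≈ fromℕ (n C k) * (f (suc k) * g (n ∸ k)) + fromℕ (n C suc k) * (f (suc k) * g (n ∸ k))
    pascal k = trans (*-congʳ (trans (reflexive (≡.cong fromℕ (≡.sym (nCk+nC[k+1]≡[n+1]C[k+1] n k))))
                                     (fromℕ-+ (n C k) (n C suc k))))
                     (distribʳ _ _ _)

    f⊛shift-g : (f ⊛ shift g) n ≈ x₀ + rest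
    f⊛shift-g = begin
      (f ⊛ shift g) n
        ≈⟨ sumTo-cong n (λ k k≤n → reflexive (≡.cong (λ i → fromℕ (n C k) * (f k * g i)) (≡.sym (ℕₚ.+-∸-assoc 1 k≤n)))) ⟩
      sumTo n (λ k → fromℕ (n C k) * (f k * g (suc n ∸ k)))
        ≈⟨ +-identityʳ _ ⟨
      sumTo n (λ k → fromℕ (n C k) * (f k * g (suc n ∸ k))) + 0#
        ≈⟨ +-congˡ (trans (*-congʳ (reflexive (≡.cong fromℕ (k>n⇒nCk≡0 (ℕₚ.n<1+n n))))) (zeroˡ _)) ⟨
      sumTo (suc n) (λ k → fromℕ (n C k) * (f k * g (suc n ∸ k)))
        ≈⟨ sumTo-suc n _ ⟩
      x₀ + rest ∎

  ⊛-scale : ∀ a b (f g : EGF) n → (scale a f ⊛ scale b g) n ≈ (a * b) * (f ⊛ g) n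
  ⊛-scale a b f g n = trans
    (sumTo-cong n (λ k _ → solve 5 (λ c x y u v → c :* ((u :* x) :* (v :* y)) := (u :* v) :* (c :* (x :* y)))
                                   refl (fromℕ (n C k)) (f k) (g (n ∸ k)) a b))
    (sym (*-distribˡ-sumTo n (a * b) _))

  powS-scale : ∀ a (f : EGF) k n → powS (scale a f) k n ≈ (a ^ k) * powS f k n
  powS-scale a f zero    n = sym (*-identityˡ _)
  powS-scale a f (suc k) n =
    trans (⊛-cong n {g′ = scale a f} (λ j _ → powS-scale a f k j) (λ _ _ → refl)) (⊛-scale (a ^ k) a (powS f k) f n)

  powS-order : ∀ (f : EGF) → f 0 ≈ 0# → ∀ k j → j < k → powS f k j ≈ 0#
  powS-order f f0≈0 (suc k) j (s≤s j≤k) = sumTo-zero j _ term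
    where
    term : ∀ i → i ≤ j → fromℕ (j C i) * (powS f k i * f (j ∸ i)) ≈ 0#
    term i i≤j with i ℕ.<? k
    ... | yes i<k = trans (*-congˡ (trans (*-congʳ (powS-order f f0≈0 k i i<k)) (zeroˡ _))) (zeroʳ _)
    ... | no  i≮k = trans (*-congˡ (trans (*-congˡ f[j∸i]≈0) (zeroʳ _))) (zeroʳ _)
      where
      f[j∸i]≈0 : f (j ∸ i) ≈ 0#
      f[j∸i]≈0 = trans (reflexive (≡.cong f (ℕₚ.m≤n⇒m∸n≡0 (ℕₚ.≤-trans j≤k (ℕₚ.≮⇒≥ i≮k))))) f0≈0

  ⊛-geom : ∀ (f y : EGF) → y 0 ≈ 0# → ∀ n → (f ⊛ geom y) n ≈ sumTo n (λ k → (f ⊛ powS y k) n)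
  ⊛-geom f y y0≈0 n = begin
    (f ⊛ geom y) n
      ≈⟨ ⊛-cong n (λ _ _ → refl) (λ j j≤n → sym (sumTo-truncate n j _ j≤n (λ k j<k _ → powS-order y y0≈0 k j j<k))) ⟩
    sumTo n (λ i → fromℕ (n C i) * (f i * sumTo n (λ k → powS y k (n ∸ i))))
      ≈⟨ sumTo-cong n (λ i _ → trans (*-congˡ (*-distribˡ-sumTo n _ _)) (*-distribˡ-sumTo n _ _)) ⟩
    sumTo n (λ i → sumTo n (λ k → fromℕ (n C i) * (f i * powS y k (n ∸ i))))
      ≈⟨ sumTo-comm n n _ ⟩
    sumTo n (λ k → (f ⊛ powS y k) n) ∎

  eλ^-0# : ∀ λ′ n → eλ^ λ′ 0# n ≈ oneS n
  eλ^-0# λ′ zero    = refl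
  eλ^-0# λ′ (suc n) = fall-0# λ′ n

  eλ^-+ : ∀ λ′ a b n → (eλ^ λ′ a ⊛ eλ^ λ′ b) n ≈ eλ^ λ′ (a + b) n
  eλ^-+ λ′ a b zero    = solve 0 ((:1 :+ :0) :* (:1 :* :1) := :1) refl
  eλ^-+ λ′ a b (suc n) = begin
    (A ⊛ B) (suc n)
      ≈⟨ ⊛-leibniz A B n ⟩
    (shift A ⊛ B) n + (A ⊛ shift B) n
      ≈⟨ sumTo-+ n _ _ ⟨
    sumTo n (λ k → fromℕ (n C k) * (shift A k * B (n ∸ k)) + fromℕ (n C k) * (A k * shift B (n ∸ k)))
      ≈⟨ sumTo-cong n term ⟩
    sumTo n (λ k → fromℕ (n C k) * (A k * B (n ∸ k)) * ((a + b) - fromℕ n * λ′))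
      ≈⟨ *-distribʳ-sumTo n _ _ ⟨
    (A ⊛ B) n * ((a + b) - fromℕ n * λ′)
      ≈⟨ *-congʳ (eλ^-+ λ′ a b n) ⟩
    eλ^ λ′ (a + b) (suc n) ∎
    where
    A B : EGF
    A = eλ^ λ′ a
    B = eλ^ λ′ b
    term : ∀ k → k ≤ n → fromℕ (n C k) * (shift A k * B (n ∸ k)) + fromℕ (n C k) * (A k * shift B (n ∸ k))
                         ≈ fromℕ (n C k) * (A k * B (n ∸ k)) * ((a + b) - fromℕ n * λ′)
    term k k≤n = begin
      fromℕ (n C k) * ((A k * (a - fromℕ k * λ′)) * B (n ∸ k))
        + fromℕ (n C k) * (A k * (B (n ∸ k) * (b - fromℕ (n ∸ k) * λ′)))
        ≈⟨ solve 8 (λ c x y a b i j l → c :* ((x :* (a :- i :* l)) :* y) :+ c :* (x :* (y :* (b :- j :* l)))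
                                         := c :* (x :* y) :* ((a :+ b) :- (i :+ j) :* l))
                   refl (fromℕ (n C k)) (A k) (B (n ∸ k)) a b (fromℕ k) (fromℕ (n ∸ k)) λ′ ⟩
      fromℕ (n C k) * (A k * B (n ∸ k)) * ((a + b) - (fromℕ k + fromℕ (n ∸ k)) * λ′)
        ≈⟨ *-congˡ (+-congˡ (-‿cong (*-congʳ k+[n∸k]≈n))) ⟩
      fromℕ (n C k) * (A k * B (n ∸ k)) * ((a + b) - fromℕ n * λ′) ∎
      where
      k+[n∸k]≈n : fromℕ k + fromℕ (n ∸ k) ≈ fromℕ n
      k+[n∸k]≈n = trans (sym (fromℕ-+ k (n ∸ k))) (reflexive (≡.cong fromℕ (ℕₚ.m+[n∸m]≡n k≤n)))

  -- Since e_λ^{c(w+1)} = e_λ^{cw} e_λ^c, multiplying by e_λ^c − 1 acts as Δ in w.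
  powS-eλ^-1 : ∀ λ′ c k n → powS (eλ^ λ′ c ⊝ oneS) k n ≈ Δ^ k (λ w → eλ^ λ′ (c * w) n) 0#
  powS-eλ^-1 λ′ c zero    n = sym (trans (fall-cong λ′ n (zeroʳ c)) (eλ^-0# λ′ n))
  powS-eλ^-1 λ′ c (suc k) n = begin
    sumTo n (λ i → fromℕ (n C i) * (powS D k i * D (n ∸ i)))
      ≈⟨ sumTo-cong n (λ i _ → trans (*-congˡ (*-congʳ (powS-eλ^-1 λ′ c k i)))
                                     (solve 3 (λ b p d → b :* (p :* d) := (b :* d) :* p) refl _ _ _)) ⟩
    sumTo n (λ i → (fromℕ (n C i) * D (n ∸ i)) * Δ^ k (λ w → eλ^ λ′ (c * w) i) 0#)
      ≈⟨ Δ^-linear k n _ (λ i w → eλ^ λ′ (c * w) i) 0# ⟨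
    Δ^ k (λ w → sumTo n (λ i → (fromℕ (n C i) * D (n ∸ i)) * eλ^ λ′ (c * w) i)) 0#
      ≈⟨ Δ^-cong k step 0# ⟩
    Δ^ (suc k) (λ w → eλ^ λ′ (c * w) n) 0# ∎
    where
    D : EGF
    D = eλ^ λ′ c ⊝ oneS
    step : ∀ w → sumTo n (λ i → (fromℕ (n C i) * D (n ∸ i)) * eλ^ λ′ (c * w) i)
                 ≈ Δ (λ v → eλ^ λ′ (c * v) n) w
    step w = begin
      sumTo n (λ i → (fromℕ (n C i) * D (n ∸ i)) * eλ^ λ′ (c * w) i)
        ≈⟨ sumTo-cong n (λ i _ → solve 3 (λ b d e → (b :* d) :* e := b :* (e :* d)) refl _ _ _) ⟩
      (eλ^ λ′ (c * w) ⊛ D) n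
        ≈⟨ ⊛-⊝ (eλ^ λ′ (c * w)) (eλ^ λ′ c) oneS n ⟩
      (eλ^ λ′ (c * w) ⊛ eλ^ λ′ c) n - (eλ^ λ′ (c * w) ⊛ oneS) n
        ≈⟨ +-cong (eλ^-+ λ′ (c * w) c n) (-‿cong (⊛-identityʳ (eλ^ λ′ (c * w)) n)) ⟩
      eλ^ λ′ (c * w + c) n - eλ^ λ′ (c * w) n
        ≈⟨ +-congʳ (fall-cong λ′ n (solve 2 (λ c w → c :* w :+ c := c :* (w :+ :1)) refl c w)) ⟩
      eλ^ λ′ (c * (w + 1#)) n - eλ^ λ′ (c * w) n ∎

  eλ-⊛-powS : ∀ λ′ c k n → (eλ λ′ ⊛ powS (eλ^ λ′ c ⊝ oneS) k) n ≈ Δ^ k (λ w → fall (c * w + 1#) λ′ n) 0#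
  eλ-⊛-powS λ′ c k n = begin
    sumTo n (λ i → fromℕ (n C i) * (eλ λ′ i * powS (eλ^ λ′ c ⊝ oneS) k (n ∸ i)))
      ≈⟨ sumTo-cong n (λ i _ → trans (*-congˡ (*-congˡ (powS-eλ^-1 λ′ c k (n ∸ i)))) (sym (*-assoc _ _ _))) ⟩
    sumTo n (λ i → (fromℕ (n C i) * eλ λ′ i) * Δ^ k (λ w → eλ^ λ′ (c * w) (n ∸ i)) 0#)
      ≈⟨ Δ^-linear k n _ (λ i w → eλ^ λ′ (c * w) (n ∸ i)) 0# ⟨
    Δ^ k (λ w → sumTo n (λ i → (fromℕ (n C i) * eλ λ′ i) * eλ^ λ′ (c * w) (n ∸ i))) 0#
      ≈⟨ Δ^-cong k (λ w → trans (sumTo-cong n (λ i _ → *-assoc _ _ _))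
                               (trans (eλ^-+ λ′ 1# (c * w) n) (fall-cong λ′ n (+-comm 1# (c * w))))) 0# ⟩
    Δ^ k (λ w → fall (c * w + 1#) λ′ n) 0# ∎

  Δ^-whitney : ∀ m λ′ W → IsDegWhitney2 m λ′ W → ∀ n k → k ≤ n →
    Δ^ k (λ w → fall (fromℕ m * w + 1#) λ′ n) 0# ≈ (W n k * (fromℕ m ^ k)) * fromℕ (k !)
  Δ^-whitney m λ′ W isWhitney n k k≤n = begin
    Δ^ k (λ w → fall (fromℕ m * w + 1#) λ′ n) 0#
      ≈⟨ Δ^-cong k (λ w → trans (isWhitney n w) (sumTo-cong n (λ j _ → sym (*-assoc _ _ _)))) 0# ⟩
    Δ^ k (λ w → sumTo n (λ j → (W n j * (fromℕ m ^ j)) * ff w j)) 0#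
      ≈⟨ Δ^-newton n k (λ j → W n j * (fromℕ m ^ j)) k≤n ⟩
    (W n k * (fromℕ m ^ k)) * fromℕ (k !) ∎

  eλ-⊛-powS-whitney : ∀ m λ′ m⁻¹ → fromℕ m * m⁻¹ ≈ 1# → ∀ W → IsDegWhitney2 m λ′ W → ∀ x n k → k ≤ n →
    (eλ λ′ ⊛ powS (scale x (scale m⁻¹ (eλ^ λ′ (fromℕ m) ⊝ oneS))) k) n ≈ fromℕ (k !) * (W n k * (x ^ k))
  eλ-⊛-powS-whitney m λ′ m⁻¹ m*m⁻¹≈1 W isWhitney x n k k≤n = begin
    (eλ λ′ ⊛ powS (scale x (scale m⁻¹ D)) k) n
      ≈⟨ ⊛-cong n {g′ = scale (x ^ k) (scale (m⁻¹ ^ k) (powS D k))} (λ _ _ → refl)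
                (λ j _ → trans (powS-scale x _ k j) (*-congˡ (powS-scale m⁻¹ D k j))) ⟩
    (eλ λ′ ⊛ scale (x ^ k) (scale (m⁻¹ ^ k) (powS D k))) n
      ≈⟨ trans (⊛-scaleʳ (x ^ k) (eλ λ′) (scale (m⁻¹ ^ k) (powS D k)) n)
               (*-congˡ (⊛-scaleʳ (m⁻¹ ^ k) (eλ λ′) (powS D k) n)) ⟩
    (x ^ k) * ((m⁻¹ ^ k) * (eλ λ′ ⊛ powS D k) n)
      ≈⟨ *-congˡ (*-congˡ (trans (eλ-⊛-powS λ′ (fromℕ m) k n) (Δ^-whitney m λ′ W isWhitney n k k≤n))) ⟩
    (x ^ k) * ((m⁻¹ ^ k) * ((W n k * (fromℕ m ^ k)) * fromℕ (k !)))
      ≈⟨ solve 5 (λ x i w p f → x :* (i :* ((w :* p) :* f)) := (f :* (w :* x)) :* (p :* i))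
               refl (x ^ k) (m⁻¹ ^ k) (W n k) (fromℕ m ^ k) (fromℕ (k !)) ⟩
    (fromℕ (k !) * (W n k * (x ^ k))) * ((fromℕ m ^ k) * (m⁻¹ ^ k))
      ≈⟨ *-congˡ (trans (sym (^-distribʳ-* (fromℕ m) m⁻¹ k)) (trans (^-congˡ k m*m⁻¹≈1) (1#^ k))) ⟩
    (fromℕ (k !) * (W n k * (x ^ k))) * 1#
      ≈⟨ *-identityʳ _ ⟩
    fromℕ (k !) * (W n k * (x ^ k)) ∎
    where
    D : EGF
    D = eλ^ λ′ (fromℕ m) ⊝ oneS

-- The identity is polynomial in λ.
theorem9 : {c ℓ : Level} (ℝ : RealField c ℓ) →
    let open RealField ℝ
        open Series ℝ
    in (m : ℕ) → .{{_ : NonZero m}} →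
       (λ′ : Carrier) → ¬ (λ′ ≈ 0#) →
       (m⁻¹ : Carrier) → fromℕ m * m⁻¹ ≈ 1# →
       (W : ℕ → ℕ → Carrier) → IsDegWhitney2 m λ′ W →
       (x : Carrier) → (n : ℕ) →
       (eλ λ′ ⊛ geom (scale x (scale m⁻¹ (eλ^ λ′ (fromℕ m) ⊝ oneS)))) n
         ≈ TannyDowling W n x
theorem9 ℝ m λ′ _ m⁻¹ m*m⁻¹≈1 W isWhitney x n = begin
  (eλ λ′ ⊛ geom G) n                   ≈⟨ ⊛-geom (eλ λ′) G G₀≈0 n ⟩
  sumTo n (λ k → (eλ λ′ ⊛ powS G k) n) ≈⟨ sumTo-cong n (eλ-⊛-powS-whitney m λ′ m⁻¹ m*m⁻¹≈1 W isWhitney x n) ⟩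
  TannyDowling W n x                   ∎
  where
  open RealField ℝ hiding (_≤_)
  open Series ℝ
  open DegenerateSeries ℝ
  open import Relation.Binary.Reasoning.Setoid setoid
  G : EGF
  G = scale x (scale m⁻¹ (eλ^ λ′ (fromℕ m) ⊝ oneS))
  G₀≈0 : G 0 ≈ 0#
  G₀≈0 = trans (*-congˡ (trans (*-congˡ (-‿inverseʳ 1#)) (zeroʳ _))) (zeroʳ _)
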